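{- Let $\mathcal{C}$ be the class of digraphs whose shortest directed cycle (if it exists) has length that is an even power of two (i.e. of the form $2^{2j}$, $j\ge0$). Then $\mathcal{C}$ is not decided by an adaptive left $k$-query algorithm over $\mathbb{N}$ for any $k$.
   Context: Digraphs are finite structures $(V,R)$, $V\ne\varnothing$, $R\subseteq V\times V$; a directed cycle of length $\ell$ is a sequence of distinct vertices $a_0,\dots,a_{\ell-1}$ with $(a_i,a_{i+1})\in R$ for $i<\ell-1$ and $(a_{\ell-1},a_0)\in R$ (a loop is a directed cycle of length 1). $\mathsf{FIN}$ is the class of all digraphs; $\hom(F,A)$ is the number of homomorphisms $F\to A$. For a set $\Sigma$, $\Sigma^{<\omega}$ is the set of finite strings over $\Sigma$; a subtree is a prefix-closed subset, a leaf an element with no proper extension in it. An adaptive left query algorithm over $\mathbb{N}$ is a function $G:\mathcal{T}\to\mathsf{FIN}\cup\{\mathsf{YES},\mathsf{NO}\}$ with $\mathcal{T}\subseteq\mathbb{N}^{<\omega}$ a subtree and $G(\sigma)\in\{\mathsf{YES},\mathsf{NO}\}$ iff $\sigma$ is a leaf. Its computation path on input $A$ is the limit of $\sigma_0=\varepsilon$, $\sigma_{i+1}=\sigma_i$ if $G(\sigma_i)\in\{\mathsf{YES},\mathsf{NO}\}$, else $\sigma_{i+1}=\sigma_i\bullet\hom(G(\sigma_i),A)$. The algorithm is required to halt (finite path) on all inputs; it decides $\{A: G(\text{path of }A)=\mathsf{YES}\}$. It is an adaptive left $k$-query algorithm if every computation path has length at most $k$. -}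

module Defs where

open import Data.Nat using (ℕ; zero; suc; _<_; _^_; _*_; _≥_)
open import Data.Fin using (Fin)
open import Data.Bool using (Bool; true; false; not; _∨_)
open import Data.Bool.ListAction using (all)
open import Data.List using (List; []; _∷_; map; concatMap; length; filter; _∷ʳ_; allFin)
open import Data.Vec using (Vec; []; _∷_; lookup)
open import Data.Product using (Σ; ∃; _×_)
open import Relation.Binary.PropositionalEquality using (_≡_)
open import Function.Definitions using (Injective)
open import Function.Bundles using (_⇔_)

record Digraph : Set where
  field
    n : ℕ
    R : Fin (suc n) → Fin (suc n) → Bool

open Digraph public

V : Digraph → Set
V A = Fin (suc (n A))

Edge : (A : Digraph) → V A → V A → Set
Edge A u v = R A u v ≡ true

allVecs : {X : Set} → List X → (m : ℕ) → List (Vec X m)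
allVecs xs zero = [] ∷ []
allVecs xs (suc m) = concatMap (λ x → map (x ∷_) (allVecs xs m)) xs

isHom : (F A : Digraph) → Vec (V A) (suc (n F)) → Bool
isHom F A f =
  all (λ u → all (λ v → not (R F u v) ∨ R A (lookup f u) (lookup f v))
                 (allFin (suc (n F))))
      (allFin (suc (n F)))

hom : Digraph → Digraph → ℕ
hom F A = length (filter (λ f → isHom F A f ≡? true)
                         (allVecs (allFin (suc (n A))) (suc (n F))))
  where
  open import Data.Bool.Properties using () renaming (_≟_ to _≡?_)

-- directed cycle of length ℓ ≥ 1: distinct vertices a₀,…,a_{ℓ-1} with
-- a_i → a_{i+1} and a_{ℓ-1} → a₀
data Next : (ℓ : ℕ) → Fin ℓ → Fin ℓ → Set where
  step : ∀ {ℓ} (i : Fin ℓ) → Next (suc ℓ) (Data.Fin.inject₁ i) (Data.Fin.suc i)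
  wrap : ∀ {ℓ} → Next (suc ℓ) (Data.Fin.fromℕ ℓ) Data.Fin.zero

HasCycle : Digraph → ℕ → Set
HasCycle A ℓ = Σ (Fin ℓ → V A) λ a →
  Injective _≡_ _≡_ a × (∀ i j → Next ℓ i j → Edge A (a i) (a j))

IsGirth : Digraph → ℕ → Set
IsGirth A ℓ = (ℓ ≥ 1) × HasCycle A ℓ × (∀ m → m ≥ 1 → m < ℓ → HasCycle A m → Data.Empty.⊥)
  where import Data.Empty

InC : Digraph → Set
InC A = ∀ ℓ → IsGirth A ℓ → ∃ λ j → ℓ ≡ 2 ^ (2 * j)

-- adaptive left query algorithms over ℕ: a node either queries a digraph
-- or answers (true = YES, false = NO)
data Node : Set where
  query  : Digraph → Node
  answer : Bool → Node

Algorithm : Set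
Algorithm = List ℕ → Node

path : Algorithm → Digraph → ℕ → List ℕ
path G A zero = []
path G A (suc i) with G (path G A i)
... | query F  = path G A i ∷ʳ hom F A
... | answer b = path G A i

-- G is an adaptive left k-query algorithm deciding 𝒞: on every input the
-- computation path reaches a leaf within k queries, and answers YES iff A ∈ 𝒞
DecidesWithin : ℕ → Algorithm → Set
DecidesWithin k G = ∀ A → Σ Bool λ b →
  (G (path G A k) ≡ answer b) × ((b ≡ true) ⇔ InC A)

-- On ℤ/N with N = 2 ^ 2 ^ k, let C d be the circulant digraph with edges x → x + d. When
-- d ∣ N its girth is N / d, so for C (2 ^ e) it is 2 ^ (2 ^ k ∸ e), and membership in the
-- class alternates with e. If g : F → C d is a homomorphism then f ↦ f + c·g is a bijection
-- from homomorphisms F → C d onto homomorphisms F → C ((1 + c) d); hence as e grows each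
-- count hom F (C (2 ^ e)) is zero up to some threshold and constant afterwards. An adversary
-- answering the k queries by bisection keeps an interval of 2 ^ (k ∸ t) + 1 exponents on which
-- the first t answers agree, so after k queries two adjacent exponents, one in the class and one
-- not, produce the same computation.
module Submission where

open import Defs
open import Algebra.Properties.CommutativeSemigroup using (xy∙z≈xz∙y)
import Algebra.Properties.CommutativeMonoid.Sum as MonoidSum
open import Data.Bool using (Bool; true; false; not; _∨_)
open import Data.Bool.ListAction using (all; and)
open import Data.Bool.Properties using (T-≡) renaming (_≟_ to _≟ᵇ_)
open import Data.Empty using (⊥; ⊥-elim)
open import Data.Fin as Fin using (Fin; toℕ; inject₁; fromℕ; _≟_)
open import Data.Fin.Induction using (<-weakInduction)
open import Data.Fin.Permutation using (Permutation; permutation; _⟨$⟩ʳ_)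
open import Data.Fin.Properties using (toℕ-fromℕ<; toℕ-injective; toℕ<n; toℕ-inject₁; toℕ-fromℕ)
open import Data.List using (List; []; _∷_; _++_; _∷ʳ_; map; concatMap; length; filter; tabulate; allFin)
open import Data.List.Properties using (filter-++; length-++; map-cong)
open import Data.List.Relation.Unary.All.Properties using (all⁺; tabulate⁻)
open import Data.Nat using (ℕ; zero; suc; pred; _+_; _*_; _^_; _≤_; _<_; _≥_; z≤n; s≤s; z<s; NonZero)
  renaming (_≟_ to _≟ℕ_)
open import Data.Nat.DivMod using (_%_; _/_; _mod_; m%n<n; m<n⇒m%n≡m; [m+kn]%n≡m%n; m≡m%n+[m/n]*n)
open import Data.Nat.Divisibility using (_∣_; divides; divides-refl; ∣-reflexive; *-cancelʳ-∣; ∣⇒≤; _∣0)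
open import Data.Nat.ListAction using (sum)
open import Data.Nat.Logarithm using (⌊log₂_⌋; ⌊log₂[2^n]⌋≡n)
open import Data.Nat.Properties
  using ( ≤-refl; ≤-trans; ≤-reflexive; ≤-antisym; <-≤-trans; ≮⇒≥; <⇒≱; m≤m+n; m<m+n; n≤1+n
        ; +-monoʳ-≤; +-comm; +-assoc; +-identityʳ; +-suc; +-cancelˡ-≡; *-comm; *-suc; *-cancelʳ-≡
        ; *-monoˡ-<; even≢odd; m≤n⇒∃[o]m+o≡n; ^-distribˡ-+-*; m^n≢0; suc-pred
        ; +-commutativeSemigroup; +-0-commutativeMonoid )
open import Data.Nat.Tactic.RingSolver using (solve-∀)
open import Data.Product using (∃; _×_; _,_)
open import Data.Sum using (_⊎_; inj₁; inj₂)
open import Data.Vec as Vec using (Vec; []; _∷_; lookup; zipWith)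
open import Data.Vec.Properties using (lookup-zipWith; lookup-map)
open import Function using (_∘_; id; _⇔_; mk⇔; Equivalence)
open import Function.Properties.Equivalence using () renaming (trans to ⇔-trans; sym to ⇔-sym)
open import Relation.Binary.PropositionalEquality
open import Relation.Nullary using (¬_; does; yes; no)
open import Relation.Nullary.Decidable using (dec-true; does-⇔)

open MonoidSum +-0-commutativeMonoid using (sum-permute) renaming (sum to ∑)

private variable X Y : Set

count : (X → Bool) → List X → ℕ
count p xs = length (filter (λ x → p x ≟ᵇ true) xs)

count-++ : ∀ (p : X → Bool) xs ys → count p (xs ++ ys) ≡ count p xs + count p ys
count-++ p xs ys =
  trans (cong length (filter-++ (λ x → p x ≟ᵇ true) xs ys)) (length-++ (filter (λ x → p x ≟ᵇ true) xs))

count-map : ∀ (p : Y → Bool) (g : X → Y) xs → count p (map g xs) ≡ count (p ∘ g) xs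
count-map p g [] = refl
count-map p g (x ∷ xs) with p (g x)
... | true  = cong suc (count-map p g xs)
... | false = count-map p g xs

count-concatMap : ∀ (p : Y → Bool) (f : X → List Y) xs →
                  count p (concatMap f xs) ≡ sum (map (count p ∘ f) xs)
count-concatMap p f [] = refl
count-concatMap p f (x ∷ xs) =
  trans (count-++ p (f x) (concatMap f xs)) (cong (count p (f x) +_) (count-concatMap p f xs))

count-cong : ∀ {p q : X → Bool} → (∀ x → p x ≡ q x) → ∀ xs → count p xs ≡ count q xs
count-cong p≗q [] = refl
count-cong {p = p} {q} p≗q (x ∷ xs) with p x | q x | p≗q x
... | true  | .true  | refl = cong suc (count-cong p≗q xs)
... | false | .false | refl = count-cong p≗q xs

count≢0⇒∃ : ∀ (p : X → Bool) xs → count p xs ≢ 0 → ∃ λ x → p x ≡ true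
count≢0⇒∃ p []       count≢0 = ⊥-elim (count≢0 refl)
count≢0⇒∃ p (x ∷ xs) count≢0 with p x in px
... | true  = x , px
... | false = count≢0⇒∃ p xs count≢0

sum-map-tabulate : ∀ {n} (g : X → ℕ) (f : Fin n → X) → sum (map g (tabulate f)) ≡ ∑ (g ∘ f)
sum-map-tabulate {n = zero}  g f = refl
sum-map-tabulate {n = suc n} g f = cong (g (f Fin.zero) +_) (sum-map-tabulate g (f ∘ Fin.suc))

sum-allFin-permute : ∀ {n} (π : Permutation n n) (g : Fin n → ℕ) →
                     sum (map (g ∘ (π ⟨$⟩ʳ_)) (allFin n)) ≡ sum (map g (allFin n))
sum-allFin-permute π g = begin
  sum (map (g ∘ (π ⟨$⟩ʳ_)) (allFin _))  ≡⟨ sum-map-tabulate (g ∘ (π ⟨$⟩ʳ_)) id ⟩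
  ∑ (g ∘ (π ⟨$⟩ʳ_))                     ≡⟨ sum-permute g π ⟨
  ∑ g                                   ≡⟨ sum-map-tabulate g id ⟨
  sum (map g (allFin _))                ∎
  where open ≡-Reasoning

module _ (N : ℕ) where

  -- hom F A unfolds to countVecs (suc (n A)) (suc (n F)) (isHom F A).
  countVecs : ∀ m → (Vec (Fin N) m → Bool) → ℕ
  countVecs m p = count p (allVecs (allFin N) m)

  countVecs-suc : ∀ m p → countVecs (suc m) p ≡ sum (map (λ x → countVecs m (p ∘ (x ∷_))) (allFin N))
  countVecs-suc m p =
    trans (count-concatMap p (λ x → map (x ∷_) (allVecs (allFin N) m)) (allFin N))
          (cong sum (map-cong (λ x → count-map p (x ∷_) (allVecs (allFin N) m)) (allFin N)))

  countVecs-permute : ∀ m (πs : Vec (Permutation N N) m) p →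
                      countVecs m (p ∘ zipWith _⟨$⟩ʳ_ πs) ≡ countVecs m p
  countVecs-permute zero [] p =
    count-cong {p = p ∘ zipWith _⟨$⟩ʳ_ []} {q = p} (λ { [] → refl }) (allVecs (allFin N) 0)
  countVecs-permute (suc m) (π ∷ πs) p = begin
    countVecs (suc m) (p ∘ zipWith _⟨$⟩ʳ_ (π ∷ πs))
      ≡⟨ countVecs-suc m _ ⟩
    sum (map (λ x → countVecs m (p ∘ ((π ⟨$⟩ʳ x) ∷_) ∘ zipWith _⟨$⟩ʳ_ πs)) (allFin N))
      ≡⟨ cong sum (map-cong (λ x → countVecs-permute m πs (p ∘ ((π ⟨$⟩ʳ x) ∷_))) (allFin N)) ⟩
    sum (map ((λ y → countVecs m (p ∘ (y ∷_))) ∘ (π ⟨$⟩ʳ_)) (allFin N))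
      ≡⟨ sum-allFin-permute π _ ⟩
    sum (map (λ y → countVecs m (p ∘ (y ∷_))) (allFin N))
      ≡⟨ countVecs-suc m p ⟨
    countVecs (suc m) p
      ∎
    where open ≡-Reasoning

all-allFin : ∀ {m} (p : Fin m → Bool) → all p (allFin m) ≡ true → ∀ i → p i ≡ true
all-allFin p all-p i = Equivalence.to T-≡ (tabulate⁻ (all⁺ p (allFin _) (Equivalence.from T-≡ all-p)) i)

isHom-edge : ∀ F A f → isHom F A f ≡ true → ∀ {u v} → Edge F u v → Edge A (lookup f u) (lookup f v)
isHom-edge F A f f-hom {u} {v} uv =
  subst (λ r → not r ∨ R A (lookup f u) (lookup f v) ≡ true) uv (all-allFin _ (all-allFin _ f-hom u) v)

isHom-cong : ∀ F A A′ f f′ →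
             (∀ u v → Edge F u v → R A (lookup f u) (lookup f v) ≡ R A′ (lookup f′ u) (lookup f′ v)) →
             isHom F A f ≡ isHom F A′ f′
isHom-cong F A A′ f f′ same-on-edges =
  cong and (map-cong (λ u → cong and (map-cong (same-at u) (allFin _))) (allFin _))
  where
  same-at : ∀ u v → not (R F u v) ∨ R A (lookup f u) (lookup f v)
                  ≡ not (R F u v) ∨ R A′ (lookup f′ u) (lookup f′ v)
  same-at u v with R F u v in uv
  ... | true  = same-on-edges u v uv
  ... | false = refl

advance : Node → List ℕ → Digraph → List ℕ
advance (query F)  σ A = σ ∷ʳ hom F A
advance (answer _) σ A = σ

path-suc-via : ∀ G A t {σ} → path G A t ≡ σ → path G A (suc t) ≡ advance (G σ) σ A
path-suc-via G A t refl with G (path G A t)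
... | query F  = refl
... | answer b = refl

decides-respects-path : ∀ k G → DecidesWithin k G →
                        ∀ A A′ → path G A k ≡ path G A′ k → InC A ⇔ InC A′
decides-respects-path k G decides A A′ same-path
  with b , G-A , b⇔A ← decides A
  with b′ , G-A′ , b′⇔A′ ← decides A′
  with refl ← trans (sym G-A) (trans (cong G same-path) G-A′) = ⇔-trans (⇔-sym b⇔A) b′⇔A′

EvenPower : ℕ → Set
EvenPower ℓ = ∃ λ j → ℓ ≡ 2 ^ (2 * j)

Even : ℕ → Set
Even m = ∃ λ j → m ≡ 2 * j

girth-unique : ∀ A {ℓ ℓ′} → IsGirth A ℓ → IsGirth A ℓ′ → ℓ ≡ ℓ′
girth-unique A {ℓ} {ℓ′} (ℓ≥1 , cycle , shortest) (ℓ′≥1 , cycle′ , shortest′) =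
  ≤-antisym (≮⇒≥ λ ℓ′<ℓ → shortest ℓ′ ℓ′≥1 ℓ′<ℓ cycle′)
            (≮⇒≥ λ ℓ<ℓ′ → shortest′ ℓ ℓ≥1 ℓ<ℓ′ cycle)

InC⇔EvenPower-girth : ∀ A {ℓ} → IsGirth A ℓ → InC A ⇔ EvenPower ℓ
InC⇔EvenPower-girth A girth =
  mk⇔ (λ inC → inC _ girth) (λ even ℓ′ girth′ → subst EvenPower (girth-unique A girth girth′) even)

2^-injective : ∀ {m n} → 2 ^ m ≡ 2 ^ n → m ≡ n
2^-injective {m} {n} eq = begin
  m                ≡⟨ ⌊log₂[2^n]⌋≡n m ⟨
  ⌊log₂ (2 ^ m) ⌋  ≡⟨ cong ⌊log₂_⌋ eq ⟩
  ⌊log₂ (2 ^ n) ⌋  ≡⟨ ⌊log₂[2^n]⌋≡n n ⟩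
  n                ∎
  where open ≡-Reasoning

EvenPower-2^⇔Even : ∀ m → EvenPower (2 ^ m) ⇔ Even m
EvenPower-2^⇔Even m = mk⇔ (λ (j , eq) → j , 2^-injective eq) (λ (j , eq) → j , cong (2 ^_) eq)

even⊎odd : ∀ m → Even m ⊎ ∃ λ j → m ≡ suc (2 * j)
even⊎odd zero = inj₁ (0 , refl)
even⊎odd (suc m) with even⊎odd m
... | inj₁ (j , m≡2j)   = inj₂ (j , cong suc m≡2j)
... | inj₂ (j , m≡2j+1) = inj₁ (suc j , trans (cong suc m≡2j+1) (sym (*-suc 2 j)))

¬Even-suc⇔Even : ∀ m → ¬ (Even (suc m) ⇔ Even m)
¬Even-suc⇔Even m iff with even⊎odd m
... | inj₁ (j , m≡2j) with j′ , 1+m≡2j′ ← Equivalence.from iff (j , m≡2j) =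
  even≢odd j′ j (trans (sym 1+m≡2j′) (cong suc m≡2j))
... | inj₂ (j , m≡2j+1)
  with j′ , m≡2j′ ← Equivalence.to iff (suc j , trans (cong suc m≡2j+1) (sym (*-suc 2 j))) =
  even≢odd j′ j (trans (sym m≡2j′) m≡2j+1)

¬EvenPower-2^suc⇔2^ : ∀ p → ¬ (EvenPower (2 ^ suc p) ⇔ EvenPower (2 ^ p))
¬EvenPower-2^suc⇔2^ p iff =
  ¬Even-suc⇔Even p (⇔-trans (⇔-sym (EvenPower-2^⇔Even (suc p))) (⇔-trans iff (EvenPower-2^⇔Even p)))

module Circulant (n₀ : ℕ) where

  N : ℕ
  N = suc n₀

  shift : ℕ → Fin N → Fin N
  shift w x = (toℕ x + w) mod N

  toℕ-shift : ∀ w x → toℕ (shift w x) ≡ (toℕ x + w) % N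
  toℕ-shift w x = toℕ-fromℕ< (m%n<n (toℕ x + w) N)

  shift-lifts : ∀ w x → ∃ λ q → toℕ x + w ≡ toℕ (shift w x) + q * N
  shift-lifts w x = (toℕ x + w) / N ,
    trans (m≡m%n+[m/n]*n (toℕ x + w) N) (cong (_+ (toℕ x + w) / N * N) (sym (toℕ-shift w x)))

  shift-≡ : ∀ {w x v y} q → toℕ x + w ≡ (toℕ y + v) + q * N → shift w x ≡ shift v y
  shift-≡ {w} {x} {v} {y} q lifts = toℕ-injective (begin
    toℕ (shift w x)            ≡⟨ toℕ-shift w x ⟩
    (toℕ x + w) % N            ≡⟨ cong (_% N) lifts ⟩
    ((toℕ y + v) + q * N) % N  ≡⟨ [m+kn]%n≡m%n (toℕ y + v) q N ⟩
    (toℕ y + v) % N            ≡⟨ toℕ-shift v y ⟨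
    toℕ (shift v y)            ∎)
    where open ≡-Reasoning

  shift-zero : ∀ x → shift 0 x ≡ x
  shift-zero x = toℕ-injective (begin
    toℕ (shift 0 x)  ≡⟨ toℕ-shift 0 x ⟩
    (toℕ x + 0) % N  ≡⟨ cong (_% N) (+-identityʳ (toℕ x)) ⟩
    toℕ x % N        ≡⟨ m<n⇒m%n≡m (toℕ<n x) ⟩
    toℕ x            ∎)
    where open ≡-Reasoning

  shift-shift : ∀ v w x → shift v (shift w x) ≡ shift (w + v) x
  shift-shift v w x with q , lifts ← shift-lifts w x = sym (shift-≡ {x = x} {y = shift w x} q (begin
    toℕ x + (w + v)              ≡⟨ +-assoc (toℕ x) w v ⟨
    toℕ x + w + v                ≡⟨ cong (_+ v) lifts ⟩
    toℕ (shift w x) + q * N + v  ≡⟨ xy∙z≈xz∙y +-commutativeSemigroup (toℕ (shift w x)) (q * N) v ⟩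
    toℕ (shift w x) + v + q * N  ∎))
    where open ≡-Reasoning

  shift-comm : ∀ v w x → shift v (shift w x) ≡ shift w (shift v x)
  shift-comm v w x = begin
    shift v (shift w x)  ≡⟨ shift-shift v w x ⟩
    shift (w + v) x      ≡⟨ cong (λ u → shift u x) (+-comm w v) ⟩
    shift (v + w) x      ≡⟨ shift-shift w v x ⟨
    shift w (shift v x)  ∎
    where open ≡-Reasoning

  shift-multiple : ∀ {w} x → N ∣ w → shift w x ≡ x
  shift-multiple x (divides-refl q) =
    trans (shift-≡ {x = x} {y = x} q (cong (_+ q * N) (sym (+-identityʳ (toℕ x))))) (shift-zero x)

  shift-fixed⇒∣ : ∀ {w x} → shift w x ≡ x → N ∣ w
  shift-fixed⇒∣ {w} {x} fixed with q , lifts ← shift-lifts w x =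
    divides q (+-cancelˡ-≡ (toℕ x) w (q * N) (trans lifts (cong (λ y → toℕ y + q * N) fixed)))

  -- n₀ * w is an additive inverse of w modulo N, with no truncated subtraction involved.
  shift-inverse : ∀ w x → shift (n₀ * w) (shift w x) ≡ x
  shift-inverse w x = trans (shift-shift (n₀ * w) w x) (shift-multiple x (divides w (*-comm N w)))

  shift-injective : ∀ w {x y} → shift w x ≡ shift w y → x ≡ y
  shift-injective w {x} {y} eq =
    trans (sym (shift-inverse w x)) (trans (cong (shift (n₀ * w)) eq) (shift-inverse w y))

  shiftPerm : ℕ → Permutation N N
  shiftPerm w = permutation (shift w) (shift (n₀ * w))
    (λ y → trans (shift-comm w (n₀ * w) y) (shift-inverse w y)) (shift-inverse w)

  shift-step : ∀ d {m} (i : Fin m) x →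
               shift d (shift (toℕ (inject₁ i) * d) x) ≡ shift (toℕ (Fin.suc i) * d) x
  shift-step d i x = trans (shift-shift d _ x) (cong (λ w → shift w x) (begin
    toℕ (inject₁ i) * d + d  ≡⟨ cong (λ t → t * d + d) (toℕ-inject₁ i) ⟩
    toℕ i * d + d            ≡⟨ +-comm (toℕ i * d) d ⟩
    d + toℕ i * d            ∎))
    where open ≡-Reasoning

  shift-wrap : ∀ d m x → shift d (shift (toℕ (fromℕ m) * d) x) ≡ shift (suc m * d) x
  shift-wrap d m x = trans (shift-shift d _ x) (cong (λ w → shift w x) (begin
    toℕ (fromℕ m) * d + d  ≡⟨ cong (λ t → t * d + d) (toℕ-fromℕ m) ⟩
    m * d + d              ≡⟨ +-comm (m * d) d ⟩
    d + m * d              ∎))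
    where open ≡-Reasoning

  circulant : ℕ → Digraph
  circulant d = record { n = n₀ ; R = λ x y → does (shift d x ≟ y) }

  circulant-edge⇔ : ∀ d x y → Edge (circulant d) x y ⇔ shift d x ≡ y
  circulant-edge⇔ d x y = mk⇔ reflect (dec-true (shift d x ≟ y))
    where
    reflect : does (shift d x ≟ y) ≡ true → shift d x ≡ y
    reflect _ with yes edge ← shift d x ≟ y = edge

  circulant-cycle : ∀ {L d} .{{_ : NonZero d}} → L * d ≡ N → HasCycle (circulant d) L
  circulant-cycle {suc L′} {d} Ld≡N = a , a-injective , edges
    where
    a : Fin (suc L′) → Fin N
    a i = shift (toℕ i * d) Fin.zero
    toℕ-a : ∀ i → toℕ (a i) ≡ toℕ i * d
    toℕ-a i = trans (toℕ-shift (toℕ i * d) Fin.zero)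
                    (m<n⇒m%n≡m (subst (toℕ i * d <_) Ld≡N (*-monoˡ-< d (toℕ<n i))))
    a-injective : ∀ {i j} → a i ≡ a j → i ≡ j
    a-injective {i} {j} ai≡aj = toℕ-injective
      (*-cancelʳ-≡ (toℕ i) (toℕ j) d (trans (sym (toℕ-a i)) (trans (cong toℕ ai≡aj) (toℕ-a j))))
    edges : ∀ i j → Next (suc L′) i j → Edge (circulant d) (a i) (a j)
    edges _ _ (step i) = Equivalence.from (circulant-edge⇔ d (a (inject₁ i)) (a (Fin.suc i)))
                                          (shift-step d i Fin.zero)
    edges _ _ wrap     = Equivalence.from (circulant-edge⇔ d (a (fromℕ L′)) (a Fin.zero)) (begin
      shift d (a (fromℕ L′))       ≡⟨ shift-wrap d L′ Fin.zero ⟩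
      shift (suc L′ * d) Fin.zero  ≡⟨ shift-multiple Fin.zero (∣-reflexive (sym Ld≡N)) ⟩
      Fin.zero                     ≡⟨ shift-zero Fin.zero ⟨
      a Fin.zero                   ∎)
      where open ≡-Reasoning

  circulant-walk : ∀ d {m} (a : Fin (suc m) → Fin N) →
                   (∀ i j → Next (suc m) i j → Edge (circulant d) (a i) (a j)) →
                   ∀ i → a i ≡ shift (toℕ i * d) (a Fin.zero)
  circulant-walk d a edges =
    <-weakInduction (λ i → a i ≡ shift (toℕ i * d) (a Fin.zero)) (sym (shift-zero (a Fin.zero))) walk-step
    where
    open ≡-Reasoning
    walk-step : ∀ j → a (inject₁ j) ≡ shift (toℕ (inject₁ j) * d) (a Fin.zero) →
                a (Fin.suc j) ≡ shift (toℕ (Fin.suc j) * d) (a Fin.zero)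
    walk-step j a-j = begin
      a (Fin.suc j)
        ≡⟨ Equivalence.to (circulant-edge⇔ d (a (inject₁ j)) (a (Fin.suc j))) (edges _ _ (step j)) ⟨
      shift d (a (inject₁ j))
        ≡⟨ cong (shift d) a-j ⟩
      shift d (shift (toℕ (inject₁ j) * d) (a Fin.zero))
        ≡⟨ shift-step d j (a Fin.zero) ⟩
      shift (toℕ (Fin.suc j) * d) (a Fin.zero)
        ∎

  circulant-cycle-length : ∀ {L d} .{{_ : NonZero d}} → L * d ≡ N →
                           ∀ {m} → HasCycle (circulant d) m → L ∣ m
  circulant-cycle-length {L} _ {zero} _ = L ∣0
  circulant-cycle-length {L} {d} Ld≡N {suc m} (a , _ , edges) =
    *-cancelʳ-∣ d (subst (_∣ suc m * d) (sym Ld≡N) (shift-fixed⇒∣ closes))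
    where
    open ≡-Reasoning
    closes : shift (suc m * d) (a Fin.zero) ≡ a Fin.zero
    closes = begin
      shift (suc m * d) (a Fin.zero)
        ≡⟨ shift-wrap d m (a Fin.zero) ⟨
      shift d (shift (toℕ (fromℕ m) * d) (a Fin.zero))
        ≡⟨ cong (shift d) (circulant-walk d a edges (fromℕ m)) ⟨
      shift d (a (fromℕ m))
        ≡⟨ Equivalence.to (circulant-edge⇔ d (a (fromℕ m)) (a Fin.zero)) (edges _ _ wrap) ⟩
      a Fin.zero
        ∎

  circulant-girth : ∀ {L d} .{{_ : NonZero d}} → L * d ≡ N → IsGirth (circulant d) L
  circulant-girth {suc L′} {d} Ld≡N = s≤s z≤n , circulant-cycle Ld≡N , shortest
    where
    shortest : ∀ m → m ≥ 1 → m < suc L′ → HasCycle (circulant d) m → ⊥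
    shortest (suc m) _ m<L cycle = <⇒≱ m<L (∣⇒≤ (circulant-cycle-length Ld≡N cycle))

  shift-along-edge : ∀ d c {gx gy} x → shift d gx ≡ gy →
                     shift (suc c * d) (shift (c * toℕ gx) x) ≡ shift (c * toℕ gy) (shift d x)
  shift-along-edge d c {gx} {gy} x edge with q , lifts ← shift-lifts d gx = begin
    shift (suc c * d) (shift (c * toℕ gx) x)  ≡⟨ shift-shift (suc c * d) (c * toℕ gx) x ⟩
    shift (c * toℕ gx + suc c * d) x          ≡⟨ shift-≡ {x = x} {y = x} (c * q) lifts′ ⟩
    shift (d + c * toℕ gy) x                  ≡⟨ shift-shift (c * toℕ gy) d x ⟨
    shift (c * toℕ gy) (shift d x)            ∎
    where
    open ≡-Reasoning
    expand : ∀ a c g d → a + (c * g + suc c * d) ≡ a + d + c * (g + d)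
    expand = solve-∀
    collect : ∀ a d c y q n → a + d + c * (y + q * n) ≡ a + (d + c * y) + c * q * n
    collect = solve-∀
    lifts′ : toℕ x + (c * toℕ gx + suc c * d) ≡ toℕ x + (d + c * toℕ gy) + c * q * N
    lifts′ = begin
      toℕ x + (c * toℕ gx + suc c * d)            ≡⟨ expand (toℕ x) c (toℕ gx) d ⟩
      toℕ x + d + c * (toℕ gx + d)                ≡⟨ cong (λ t → toℕ x + d + c * t) lifts ⟩
      toℕ x + d + c * (toℕ (shift d gx) + q * N)
        ≡⟨ cong (λ y → toℕ x + d + c * (toℕ y + q * N)) edge ⟩
      toℕ x + d + c * (toℕ gy + q * N)            ≡⟨ collect (toℕ x) d c (toℕ gy) q N ⟩
      toℕ x + (d + c * toℕ gy) + c * q * N        ∎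

  circulant-R-shift : ∀ d c {gx gy} x y → Edge (circulant d) gx gy →
                      R (circulant (suc c * d)) (shift (c * toℕ gx) x) (shift (c * toℕ gy) y)
                        ≡ R (circulant d) x y
  circulant-R-shift d c {gx} {gy} x y g-edge =
    does-⇔ (mk⇔ (shift-injective (c * toℕ gy) ∘ trans (sym along))
                (λ edge → trans along (cong (shift (c * toℕ gy)) edge)))
           (shift (suc c * d) (shift (c * toℕ gx) x) ≟ shift (c * toℕ gy) y) (shift d x ≟ y)
    where
    along = shift-along-edge d c x (Equivalence.to (circulant-edge⇔ d gx gy) g-edge)

  module _ (F : Digraph) (d c : ℕ) where

    shiftAlong : Vec (Fin N) (suc (n F)) → Vec (Permutation N N) (suc (n F))
    shiftAlong g = Vec.map (λ y → shiftPerm (c * toℕ y)) g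

    isHom-shiftAlong : ∀ g → isHom F (circulant d) g ≡ true → ∀ f →
                       isHom F (circulant (suc c * d)) (zipWith _⟨$⟩ʳ_ (shiftAlong g) f)
                         ≡ isHom F (circulant d) f
    isHom-shiftAlong g g-hom f = isHom-cong F (circulant (suc c * d)) (circulant d) f′ f λ u v uv → begin
      R (circulant (suc c * d)) (lookup f′ u) (lookup f′ v)
        ≡⟨ cong₂ (R (circulant (suc c * d))) (lookup-shifted u) (lookup-shifted v) ⟩
      R (circulant (suc c * d)) (shift (c * toℕ (lookup g u)) (lookup f u))
                                (shift (c * toℕ (lookup g v)) (lookup f v))
        ≡⟨ circulant-R-shift d c (lookup f u) (lookup f v) (isHom-edge F (circulant d) g g-hom uv) ⟩
      R (circulant d) (lookup f u) (lookup f v)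
        ∎
      where
      open ≡-Reasoning
      f′ = zipWith _⟨$⟩ʳ_ (shiftAlong g) f
      lookup-shifted : ∀ u → lookup f′ u ≡ shift (c * toℕ (lookup g u)) (lookup f u)
      lookup-shifted u = trans (lookup-zipWith _⟨$⟩ʳ_ u (shiftAlong g) f)
        (cong (_⟨$⟩ʳ lookup f u) {x = lookup (shiftAlong g) u}
              (lookup-map u (λ y → shiftPerm (c * toℕ y)) g))

  hom-circulant-multiple : ∀ F d c → hom F (circulant d) ≢ 0 →
                           hom F (circulant (suc c * d)) ≡ hom F (circulant d)
  hom-circulant-multiple F d c hom≢0
    with g , g-hom ← count≢0⇒∃ (isHom F (circulant d)) (allVecs (allFin N) (suc (n F))) hom≢0 = begin
    hom F (circulant (suc c * d))
      ≡⟨ countVecs-permute N _ (shiftAlong F d c g) (isHom F (circulant (suc c * d))) ⟨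
    countVecs N _ (isHom F (circulant (suc c * d)) ∘ zipWith _⟨$⟩ʳ_ (shiftAlong F d c g))
      ≡⟨ count-cong (isHom-shiftAlong F d c g g-hom) (allVecs (allFin N) (suc (n F))) ⟩
    hom F (circulant d)
      ∎
    where open ≡-Reasoning

HomsStabilise : (ℕ → Digraph) → Set
HomsStabilise B = ∀ F {e e′} → e ≤ e′ → hom F (B e) ≢ 0 → hom F (B e′) ≡ hom F (B e)

ConstantOn : (ℕ → X) → ℕ → ℕ → Set
ConstantOn f a b = ∀ e → a ≤ e → e ≤ b → f e ≡ f a

module _ (B : ℕ → Digraph) (stabilise : HomsStabilise B) (G : Algorithm) where

  homs-vanish-below : ∀ F {e e′} → e ≤ e′ → hom F (B e′) ≡ 0 → hom F (B e) ≡ 0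
  homs-vanish-below F {e} e≤e′ vanishes with hom F (B e) ≟ℕ 0
  ... | yes vanishes-at-e = vanishes-at-e
  ... | no nonzero        = ⊥-elim (nonzero (trans (sym (stabilise F e≤e′ nonzero)) vanishes))

  advance-constant : ∀ node σ a w → ∃ λ a′ → a ≤ a′ × a′ + w ≤ a + 2 * w ×
                     ConstantOn (λ e → advance node σ (B e)) a′ (a′ + w)
  advance-constant (answer _) σ a w = a , ≤-refl , +-monoʳ-≤ a (m≤m+n w (w + 0)) , λ _ _ _ → refl
  advance-constant (query F)  σ a w with hom F (B (a + w)) ≟ℕ 0
  ... | yes vanishes = a , ≤-refl , +-monoʳ-≤ a (m≤m+n w (w + 0)) ,
    λ e _ e≤a+w → cong (σ ∷ʳ_) (trans (homs-vanish-below F e≤a+w vanishes)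
                                      (sym (homs-vanish-below F (m≤m+n a w) vanishes)))
  ... | no nonzero   = a + w , m≤m+n a w ,
    ≤-reflexive (trans (+-assoc a w w) (cong (λ v → a + (w + v)) (sym (+-identityʳ w)))) ,
    λ e a+w≤e _ → cong (σ ∷ʳ_) (stabilise F a+w≤e nonzero)

  halve : ∀ t a w → ConstantOn (λ e → path G (B e) t) a (a + 2 * w) →
          ∃ λ a′ → a ≤ a′ × a′ + w ≤ a + 2 * w ×
                   ConstantOn (λ e → path G (B e) (suc t)) a′ (a′ + w)
  halve t a w agree
    with a′ , a≤a′ , a′+w≤a+2w , constant ← advance-constant (G (path G (B a) t)) (path G (B a) t) a w =
    a′ , a≤a′ , a′+w≤a+2w , λ e a′≤e e≤a′+w → begin
      path G (B e) (suc t)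
        ≡⟨ path-suc-via G (B e) t (agree e (≤-trans a≤a′ a′≤e) (≤-trans e≤a′+w a′+w≤a+2w)) ⟩
      advance (G σ) σ (B e)
        ≡⟨ constant e a′≤e e≤a′+w ⟩
      advance (G σ) σ (B a′)
        ≡⟨ path-suc-via G (B a′) t (agree a′ a≤a′ (≤-trans (m≤m+n a′ w) a′+w≤a+2w)) ⟨
      path G (B a′) (suc t)
        ∎
    where
    open ≡-Reasoning
    σ = path G (B a) t

  bisect : ∀ s t a → ConstantOn (λ e → path G (B e) t) a (a + 2 ^ s) →
           ∃ λ a′ → a ≤ a′ × a′ < a + 2 ^ s × ConstantOn (λ e → path G (B e) (s + t)) a′ (a′ + 1)
  bisect zero    t a agree = a , ≤-refl , m<m+n a z<s , agree
  bisect (suc s) t a agree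
    with a₁ , a≤a₁ , a₁+w≤a+2w , agree₁ ← halve t a (2 ^ s) agree
    with a₂ , a₁≤a₂ , a₂<a₁+w , agree₂ ← bisect s (suc t) a₁ agree₁ =
    a₂ , ≤-trans a≤a₁ a₁≤a₂ , <-≤-trans a₂<a₁+w a₁+w≤a+2w ,
    subst (λ t′ → ConstantOn (λ e → path G (B e) t′) a₂ (a₂ + 1)) (+-suc s t) agree₂

  neighbours-indistinguishable : ∀ k → ∃ λ a → a < 2 ^ k × path G (B (suc a)) k ≡ path G (B a) k
  neighbours-indistinguishable k with a , _ , a<2^k , agree ← bisect k 0 0 (λ _ _ _ → refl) =
    a , a<2^k , subst (λ t → path G (B (suc a)) t ≡ path G (B a) t) (+-identityʳ k)
                      (agree (suc a) (n≤1+n a) (≤-reflexive (+-comm 1 a)))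

module _ (M : ℕ) where

  private instance
    2^M≢0 : NonZero (2 ^ M)
    2^M≢0 = m^n≢0 2 M

  open Circulant (pred (2 ^ M))

  powerCirculant : ℕ → Digraph
  powerCirculant e = circulant (2 ^ e)

  powerCirculant-stabilise : HomsStabilise powerCirculant
  powerCirculant-stabilise F {e} {e′} e≤e′ nonzero with o , e+o≡e′ ← m≤n⇒∃[o]m+o≡n e≤e′ =
    trans (cong (λ d → hom F (circulant d)) 2^e′≡[1+c]*2^e)
          (hom-circulant-multiple F (2 ^ e) (pred (2 ^ o)) nonzero)
    where
    open ≡-Reasoning
    2^e′≡[1+c]*2^e : 2 ^ e′ ≡ suc (pred (2 ^ o)) * 2 ^ e
    2^e′≡[1+c]*2^e = begin
      2 ^ e′                      ≡⟨ cong (2 ^_) (trans (sym e+o≡e′) (+-comm e o)) ⟩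
      2 ^ (o + e)                 ≡⟨ ^-distribˡ-+-* 2 o e ⟩
      2 ^ o * 2 ^ e               ≡⟨ cong (_* 2 ^ e) (suc-pred (2 ^ o) {{m^n≢0 2 o}}) ⟨
      suc (pred (2 ^ o)) * 2 ^ e  ∎

  powerCirculant-InC⇔ : ∀ e g → e + g ≡ M → InC (powerCirculant e) ⇔ EvenPower (2 ^ g)
  powerCirculant-InC⇔ e g e+g≡M =
    InC⇔EvenPower-girth (powerCirculant e) (circulant-girth {{m^n≢0 2 e}} 2^g*2^e≡N)
    where
    open ≡-Reasoning
    2^g*2^e≡N : 2 ^ g * 2 ^ e ≡ suc (pred (2 ^ M))
    2^g*2^e≡N = begin
      2 ^ g * 2 ^ e       ≡⟨ ^-distribˡ-+-* 2 g e ⟨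
      2 ^ (g + e)         ≡⟨ cong (2 ^_) (trans (+-comm g e) e+g≡M) ⟩
      2 ^ M               ≡⟨ suc-pred (2 ^ M) ⟨
      suc (pred (2 ^ M))  ∎

theorem15 : (k : ℕ) (G : Algorithm) → ¬ DecidesWithin k G
theorem15 k G decides =
  let a , a<M , same-path = neighbours-indistinguishable (powerCirculant M) (powerCirculant-stabilise M) G k
      p , 1+a+p≡M         = m≤n⇒∃[o]m+o≡n a<M
  in ¬EvenPower-2^suc⇔2^ p
       (⇔-trans (⇔-sym (powerCirculant-InC⇔ M a (suc p) (trans (+-suc a p) 1+a+p≡M)))
       (⇔-trans (decides-respects-path k G decides _ _ (sym same-path))
                (powerCirculant-InC⇔ M (suc a) p 1+a+p≡M)))
  where
  M = 2 ^ k
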